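{- Let $n\geq 1$ and $0\leq t\leq\binom{n}{2}$ be integers. For an integer $s$ let $I_n(s)$ be the number of permutations of $\{1,\ldots,n\}$ with exactly $s$ inversions. Then $$\sum_{i=0}^t I_n(i)=\binom{n+t}{t}+\sum_{j=1}^n\ \sum_{k=\binom{j+1}{2}}^{\binom{n+1}{2}}(-1)^j\,[q^{\,k-\binom{j+1}{2}}]\Big[{n\atop j}\Big]_q\cdot\binom{t-k+n}{n}_0,$$ where $[q^m]\Big[{n\atop j}\Big]_q$ denotes the coefficient of $q^m$ in the Gaussian polynomial $\Big[{n\atop j}\Big]_q$.
   Context: An inversion of a permutation $(a_1,\ldots,a_n)$ of $\{1,\ldots,n\}$ is a pair $(a_i,a_j)$ with $i<j$ and $a_i>a_j$. The restricted binomial coefficient is defined for integers $a$ and $k\ge0$ by $\binom{a}{k}_0=\binom{a}{k}$ if $a\geq k$ and $\binom{a}{k}_0=0$ otherwise. The $q$-factorial is $[m]_q!=(1+q)(1+q+q^2)\cdots(1+q+\cdots+q^{m-1})$ (with $[0]_q!=[1]_q!=1$), and the Gaussian polynomial (q-binomial coefficient) is $\Big[{n\atop m}\Big]_q=\frac{[n]_q!}{[n-m]_q!\,[m]_q!}$ for $0\le m\le n$, which is a polynomial in $q$ with integer coefficients. -}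

module Defs where

open import Data.Nat as ℕ using (ℕ; zero; suc; _∸_; _<ᵇ_; _≡ᵇ_)
open import Data.Nat.Combinatorics using (_C_)
open import Data.Integer as ℤ using (ℤ; +_; -_)
open import Data.Fin using (Fin; toℕ)
open import Data.Fin.Properties using () renaming (_≟_ to _≟ᶠ_)
open import Data.Bool using (Bool; true; false; _∧_; not; if_then_else_)
open import Data.List as List using (List; []; _∷_; concatMap; map; upTo; length; filter)
open import Data.Vec as Vec using (Vec; []; _∷_)
open import Relation.Nullary using (does)
open import Data.Nat.ListAction using () renaming (sum to sumN)

allWords : (n m : ℕ) → List (Vec (Fin m) n)
allWords zero    m = [] ∷ []
allWords (suc n) m = concatMap (λ x → map (x ∷_) (allWords n m)) (List.allFin m)

notIn : ∀ {m k} → Fin m → Vec (Fin m) k → Bool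
notIn x []       = true
notIn x (y ∷ ys) = not (does (x ≟ᶠ y)) ∧ notIn x ys

distinct : ∀ {m k} → Vec (Fin m) k → Bool
distinct []       = true
distinct (x ∷ xs) = notIn x xs ∧ distinct xs

-- all permutations of {1,…,n}, written in one-line notation over Fin n
permutations : (n : ℕ) → List (Vec (Fin n) n)
permutations n = filter (λ w → Data.Bool.T? (distinct w)) (allWords n n)
  where import Data.Bool

greaterCount : ∀ {m k} → Fin m → Vec (Fin m) k → ℕ
greaterCount x []       = 0
greaterCount x (y ∷ ys) = (if toℕ y <ᵇ toℕ x then 1 else 0) ℕ.+ greaterCount x ys

inversions : ∀ {m k} → Vec (Fin m) k → ℕ
inversions []       = 0
inversions (x ∷ xs) = greaterCount x xs ℕ.+ inversions xs

I : ℕ → ℕ → ℕ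
I n s = length (filter (λ w → Data.Bool.T? (inversions w ≡ᵇ s)) (permutations n))
  where import Data.Bool

sumℤ : List ℤ → ℤ
sumℤ = List.foldr ℤ._+_ (+ 0)

-- Σ_{i=a}^{b} f i  (empty if b < a)
Σℕ[_to_] : ℕ → ℕ → (ℕ → ℕ) → ℕ
Σℕ[ a to b ] f = sumN (map (λ i → f (a ℕ.+ i)) (upTo (suc b ∸ a)))

Σℤ[_to_] : ℕ → ℕ → (ℕ → ℤ) → ℤ
Σℤ[ a to b ] f = sumℤ (map (λ i → f (a ℕ.+ i)) (upTo (suc b ∸ a)))

binom₀ : ℤ → ℕ → ℕ
binom₀ (+ a)     k = if a <ᵇ k then 0 else a C k
binom₀ (ℤ.-[1+ _ ]) k = 0

-- Polynomials in q with integer coefficients: coefficient lists,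
-- constant term first.

Poly : Set
Poly = List ℤ

coeff : Poly → ℕ → ℤ
coeff []       _       = + 0
coeff (c ∷ _)  zero    = c
coeff (_ ∷ cs) (suc m) = coeff cs m

_⊕_ : Poly → Poly → Poly
[]       ⊕ q        = q
(a ∷ p)  ⊕ []       = a ∷ p
(a ∷ p)  ⊕ (b ∷ q)  = (a ℤ.+ b) ∷ (p ⊕ q)

scale : ℤ → Poly → Poly
scale c = map (c ℤ.*_)

_⊗_ : Poly → Poly → Poly
[]      ⊗ q = []
(a ∷ p) ⊗ q = scale a q ⊕ (+ 0 ∷ (p ⊗ q))

qint : ℕ → Poly
qint m = List.replicate m (+ 1)

qfact : ℕ → Poly
qfact zero    = + 1 ∷ []
qfact (suc m) = qfact m ⊗ qint (suc m)

-- Coefficients of the quotient P / Q (as a power series in q), for Q with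
-- constant term 1:  c_m = p_m − Σ_{i=1}^{m} q_i c_{m−i}.
-- When Q divides P in ℤ[q], these are the coefficients of the polynomial P/Q.
divCoeffs : Poly → Poly → ℕ → List ℤ   -- list [c_m, c_{m-1}, …, c_0]
divCoeffs P Q zero    = coeff P 0 ∷ []
divCoeffs P Q (suc m) =
  let prev = divCoeffs P Q m
      s    = sumℤ (List.zipWith ℤ._*_ (map (λ i → coeff Q (suc i)) (upTo (suc m))) prev)
  in (coeff P (suc m) ℤ.- s) ∷ prev

quotCoeff : Poly → Poly → ℕ → ℤ
quotCoeff P Q m with divCoeffs P Q m
... | c ∷ _ = c
... | []    = + 0

gaussCoeff : ℕ → ℕ → ℕ → ℤ
gaussCoeff n j m = quotCoeff (qfact n) (qfact (n ∸ j) ⊗ qfact j) m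

-- Removing the first letter x of a permutation of a set Q removes exactly rank Q x
-- inversions, and the ranks of the elements of Q are 0, 1, …, ∣Q∣ - 1; hence the
-- inversion generating function of permutations of {1,…,n} is [n]_q!.  So the partial
-- sums Σ_{i ≤ t} I_n(i) are the coefficients of [n]_q!/(1 - q) = (q;q)_n/(1 - q)^(n+1).
-- Expand (q;q)_n = Σ_j (-1)^j q^(j(j+1)/2) [n choose j]_q by the q-binomial theorem
-- (the Gaussian polynomials are built by the q-Pascal rule and matched with the
-- quotient [n]_q!/([n-j]_q! [j]_q!) through [j]_q! [n-j]_q! [n choose j]_q = [n]_q!) and
-- 1/(1 - q)^(n+1) = Σ_m C(m+n, n) q^m; the coefficient of q^t is the claimed double sum,
-- whose j = 0 term is C(n+t, t).

module Submission where

open import Defs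
open import Algebra.Bundles using (CommutativeMonoid)
import Algebra.Properties.CommutativeSemigroup as CommutativeSemigroupProperties
import Algebra.Properties.Semiring.Sum as SemiringSum
open import Data.Bool using (Bool; true; false; T?; _∧_; not; if_then_else_)
open import Data.Bool.Properties using (∧-commutativeMonoid; ∧-conicalˡ; ∧-conicalʳ; ∧-identityʳ; ∧-comm; ∧-assoc)
open import Data.Fin using (Fin; toℕ) renaming (zero to fzero; suc to fsuc)
open import Data.Fin.Properties using (toℕ<n; _≟_)
open import Data.Integer as Int using (ℤ; +_; -_; _*_; _-_; _^_; _⊖_)
import Data.Integer.Properties as ℤP
open import Data.Integer.Tactic.RingSolver using (solve-∀)
open import Data.List using (List; []; _∷_; _++_; map; concatMap; filter; length; allFin; tabulate; applyUpTo; applyDownFrom; upTo; zipWith)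
open import Data.List.Properties using (map-applyUpTo)
open import Data.Nat as ℕ using (ℕ; zero; suc; _≤_; _<_; z≤n; s≤s; _∸_; _<ᵇ_)
open import Data.Nat.Combinatorics using (_C_; nCn≡1; nC1≡n; nCk≡nC[n∸k]; nCk+nC[k+1]≡[n+1]C[k+1])
open import Data.Nat.ListAction using () renaming (sum to sumN)
import Data.Nat.Properties as ℕP
import Data.Nat.Tactic.RingSolver as ℕSolver
open import Data.Product using (_,_)
open import Data.Vec using (Vec; []; _∷_)
open import Function using (_∘_; id)
open import Level using (0ℓ)
open import Relation.Binary.Bundles using (Setoid)
open import Relation.Binary.PropositionalEquality
import Relation.Binary.Reasoning.Setoid as SetoidReasoning
open import Relation.Nullary using (does; yes; no; contradiction)
open import Relation.Nullary.Reflects using (ofʸ; ofⁿ)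

open CommutativeSemigroupProperties ℕP.+-commutativeSemigroup using () renaming (x∙yz≈y∙xz to x+yz≡y+xz)
open CommutativeSemigroupProperties (CommutativeMonoid.commutativeSemigroup ∧-commutativeMonoid)
  using () renaming (x∙yz≈y∙xz to x∧yz≡y∧xz; interchange to ∧-interchange)

module ℤΣ = SemiringSum ℤP.+-*-semiring
module ℕΣ = SemiringSum ℕP.+-*-semiring

-- ℤ's _+_ is opened only in this anonymous module: the statement of theorem3p2 uses ℕ's.
module _ where
  open import Data.Integer using (_+_)

  ∑< : ℕ → (ℕ → ℤ) → ℤ
  ∑< N f = ℤΣ.sum {N} (f ∘ toℕ)

  ∑<-cong : ∀ N {f g : ℕ → ℤ} → f ≗ g → ∑< N f ≡ ∑< N g
  ∑<-cong N f≗g = ℤΣ.sum-cong-≗ {N} (f≗g ∘ toℕ)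

  ∑<-cong-< : ∀ N {f g : ℕ → ℤ} → (∀ i → i < N → f i ≡ g i) → ∑< N f ≡ ∑< N g
  ∑<-cong-< N f≡g = ℤΣ.sum-cong-≗ {N} (λ i → f≡g (toℕ i) (toℕ<n i))

  ∑<-zero : ∀ N {f : ℕ → ℤ} → (∀ i → i < N → f i ≡ + 0) → ∑< N f ≡ + 0
  ∑<-zero N f≡0 = trans (∑<-cong-< N f≡0) (ℤΣ.sum-replicate-zero N)

  ∑<-split : ∀ M N (f : ℕ → ℤ) → ∑< (M ℕ.+ N) f ≡ ∑< M f + ∑< N (λ i → f (M ℕ.+ i))
  ∑<-split zero    N f = sym (ℤP.+-identityˡ _)
  ∑<-split (suc M) N f = trans (cong (_+_ (f 0)) (∑<-split M N (f ∘ suc))) (sym (ℤP.+-assoc (f 0) _ _))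

  ∑<-last : ∀ N (f : ℕ → ℤ) → ∑< (suc N) f ≡ ∑< N f + f N
  ∑<-last N f = begin
    ∑< (suc N) f              ≡⟨ cong (λ M → ∑< M f) (ℕP.+-comm 1 N) ⟩
    ∑< (N ℕ.+ 1) f            ≡⟨ ∑<-split N 1 f ⟩
    ∑< N f + (f (N ℕ.+ 0) + + 0) ≡⟨ cong (λ x → ∑< N f + x) (trans (ℤP.+-identityʳ _) (cong f (ℕP.+-identityʳ N))) ⟩
    ∑< N f + f N              ∎
    where open ≡-Reasoning

  ∑<-+ : ∀ N (f g : ℕ → ℤ) → ∑< N (λ i → f i + g i) ≡ ∑< N f + ∑< N g
  ∑<-+ N f g = ℤΣ.∑-distrib-+ {N} (f ∘ toℕ) (g ∘ toℕ)

  ∑<-comm : ∀ M N (f : ℕ → ℕ → ℤ) → ∑< M (λ i → ∑< N (f i)) ≡ ∑< N (λ j → ∑< M (λ i → f i j))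
  ∑<-comm M N f = ℤΣ.∑-comm {M} {N} (λ i j → f (toℕ i) (toℕ j))

  ∑<-*ˡ : ∀ N c (f : ℕ → ℤ) → c * ∑< N f ≡ ∑< N (λ i → c * f i)
  ∑<-*ˡ N c f = ℤΣ.*-distribˡ-sum {N} c (f ∘ toℕ)

  ∑<-*ʳ : ∀ N c (f : ℕ → ℤ) → ∑< N f * c ≡ ∑< N (λ i → f i * c)
  ∑<-*ʳ N c f = ℤΣ.*-distribʳ-sum {N} c (f ∘ toℕ)

  ∑<-extend : ∀ {M N} (f : ℕ → ℤ) → M ≤ N → (∀ i → M ≤ i → f i ≡ + 0) → ∑< M f ≡ ∑< N f
  ∑<-extend {M} {N} f M≤N f≡0 = begin
    ∑< M f                                         ≡⟨ ℤP.+-identityʳ _ ⟨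
    ∑< M f + + 0                                   ≡⟨ cong (_+_ (∑< M f)) (∑<-zero (N ∸ M) (λ i _ → f≡0 (M ℕ.+ i) (ℕP.m≤m+n M i))) ⟨
    ∑< M f + ∑< (N ∸ M) (λ i → f (M ℕ.+ i))        ≡⟨ ∑<-split M (N ∸ M) f ⟨
    ∑< (M ℕ.+ (N ∸ M)) f                           ≡⟨ cong (λ K → ∑< K f) (ℕP.m+[n∸m]≡n M≤N) ⟩
    ∑< N f                                         ∎
    where open ≡-Reasoning

  ∑<-drop : ∀ {a N} (f : ℕ → ℤ) → a ≤ N → (∀ i → i < a → f i ≡ + 0) → ∑< N f ≡ ∑< (N ∸ a) (λ i → f (a ℕ.+ i))
  ∑<-drop {a} {N} f a≤N f≡0 = begin
    ∑< N f                                         ≡⟨ cong (λ K → ∑< K f) (ℕP.m+[n∸m]≡n a≤N) ⟨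
    ∑< (a ℕ.+ (N ∸ a)) f                           ≡⟨ ∑<-split a (N ∸ a) f ⟩
    ∑< a f + ∑< (N ∸ a) (λ i → f (a ℕ.+ i))        ≡⟨ cong (_+ ∑< (N ∸ a) (λ i → f (a ℕ.+ i))) (∑<-zero a f≡0) ⟩
    + 0 + ∑< (N ∸ a) (λ i → f (a ℕ.+ i))           ≡⟨ ℤP.+-identityˡ _ ⟩
    ∑< (N ∸ a) (λ i → f (a ℕ.+ i))                 ∎
    where open ≡-Reasoning

  sumN-applyUpTo : ∀ (f : ℕ → ℕ) N → + sumN (applyUpTo f N) ≡ ∑< N (+_ ∘ f)
  sumN-applyUpTo f zero    = refl
  sumN-applyUpTo f (suc N) = trans (ℤP.pos-+ (f 0) _) (cong (_+_ (+ f 0)) (sumN-applyUpTo (f ∘ suc) N))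

  sumℤ-applyUpTo : ∀ (f : ℕ → ℤ) N → sumℤ (applyUpTo f N) ≡ ∑< N f
  sumℤ-applyUpTo f zero    = refl
  sumℤ-applyUpTo f (suc N) = cong (_+_ (f 0)) (sumℤ-applyUpTo (f ∘ suc) N)

  Σℕ-∑< : ∀ t f → + Σℕ[ 0 to t ] f ≡ ∑< (suc t) (+_ ∘ f)
  Σℕ-∑< t f = trans (cong (+_ ∘ sumN) (map-applyUpTo id f (suc t))) (sumN-applyUpTo f (suc t))

  Σℤ-∑< : ∀ a b f → Σℤ[ a to b ] f ≡ ∑< (suc b ∸ a) (λ i → f (a ℕ.+ i))
  Σℤ-∑< a b f = trans (cong sumℤ (map-applyUpTo id (λ i → f (a ℕ.+ i)) (suc b ∸ a))) (sumℤ-applyUpTo _ (suc b ∸ a))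

  -- Formal power series

  Series : Set
  Series = ℕ → ℤ

  module ≗-Reasoning = SetoidReasoning (ℕ →-setoid ℤ)

  infixl 6 _+ₛ_
  infixl 7 _*ₛ_ _·ₛ_

  0ₛ : Series
  0ₛ _ = + 0

  1ₛ : Series
  1ₛ zero    = + 1
  1ₛ (suc _) = + 0

  _+ₛ_ : Series → Series → Series
  (f +ₛ g) m = f m + g m

  _·ₛ_ : ℤ → Series → Series
  (c ·ₛ f) m = c * f m

  tailₛ : Series → Series
  tailₛ f m = f (suc m)

  _*ₛ_ : Series → Series → Series
  (f *ₛ g) zero    = f 0 * g 0
  (f *ₛ g) (suc m) = f 0 * g (suc m) + (tailₛ f *ₛ g) m

  -- multiplication by q^k
  shift : ℕ → Series → Series
  shift zero    f         = f
  shift (suc k) f zero    = + 0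
  shift (suc k) f (suc m) = shift k f m

  *ₛ-coeff : ∀ f g m → (f *ₛ g) m ≡ ∑< (suc m) (λ i → f i * g (m ∸ i))
  *ₛ-coeff f g zero    = sym (ℤP.+-identityʳ _)
  *ₛ-coeff f g (suc m) = cong (_+_ (f 0 * g (suc m))) (*ₛ-coeff (tailₛ f) g m)

  +ₛ-cong : ∀ {f f′ g g′} → f ≗ f′ → g ≗ g′ → f +ₛ g ≗ f′ +ₛ g′
  +ₛ-cong f≗f′ g≗g′ m = cong₂ _+_ (f≗f′ m) (g≗g′ m)

  +ₛ-congʳ : ∀ f {g g′} → g ≗ g′ → f +ₛ g ≗ f +ₛ g′
  +ₛ-congʳ f g≗g′ m = cong (_+_ (f m)) (g≗g′ m)

  ·ₛ-congʳ : ∀ c {f g} → f ≗ g → c ·ₛ f ≗ c ·ₛ g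
  ·ₛ-congʳ c f≗g m = cong (c *_) (f≗g m)

  *ₛ-congˡ : ∀ {f f′} g → f ≗ f′ → f *ₛ g ≗ f′ *ₛ g
  *ₛ-congˡ g f≗f′ zero    = cong (_* g 0) (f≗f′ 0)
  *ₛ-congˡ g f≗f′ (suc m) = cong₂ _+_ (cong (_* g (suc m)) (f≗f′ 0)) (*ₛ-congˡ g (f≗f′ ∘ suc) m)

  *ₛ-congʳ : ∀ f {g g′} → g ≗ g′ → f *ₛ g ≗ f *ₛ g′
  *ₛ-congʳ f g≗g′ zero    = cong (f 0 *_) (g≗g′ 0)
  *ₛ-congʳ f g≗g′ (suc m) = cong₂ _+_ (cong (f 0 *_) (g≗g′ (suc m))) (*ₛ-congʳ (tailₛ f) g≗g′ m)

  *ₛ-cong : ∀ {f f′ g g′} → f ≗ f′ → g ≗ g′ → f *ₛ g ≗ f′ *ₛ g′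
  *ₛ-cong {f′ = f′} {g} f≗f′ g≗g′ m = trans (*ₛ-congˡ g f≗f′ m) (*ₛ-congʳ f′ g≗g′ m)

  *ₛ-zeroˡ : ∀ g → 0ₛ *ₛ g ≗ 0ₛ
  *ₛ-zeroˡ g zero    = refl
  *ₛ-zeroˡ g (suc m) = trans (ℤP.+-identityˡ _) (*ₛ-zeroˡ g m)

  *ₛ-identityˡ : ∀ g → 1ₛ *ₛ g ≗ g
  *ₛ-identityˡ g zero    = ℤP.*-identityˡ (g 0)
  *ₛ-identityˡ g (suc m) =
    trans (cong₂ _+_ (ℤP.*-identityˡ (g (suc m))) (*ₛ-zeroˡ g m)) (ℤP.+-identityʳ _)

  *ₛ-distribʳ : ∀ f f′ g → (f +ₛ f′) *ₛ g ≗ f *ₛ g +ₛ f′ *ₛ g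
  *ₛ-distribʳ f f′ g zero    = ℤP.*-distribʳ-+ (g 0) (f 0) (f′ 0)
  *ₛ-distribʳ f f′ g (suc m) =
    trans (cong₂ _+_ (ℤP.*-distribʳ-+ (g (suc m)) (f 0) (f′ 0)) (*ₛ-distribʳ (tailₛ f) (tailₛ f′) g m))
          (interchange (f 0 * g (suc m)) (f′ 0 * g (suc m)) ((tailₛ f *ₛ g) m) ((tailₛ f′ *ₛ g) m))
    where
    interchange : ∀ a b c d → (a + b) + (c + d) ≡ (a + c) + (b + d)
    interchange = solve-∀

  ·ₛ-*ₛ : ∀ c f g → (c ·ₛ f) *ₛ g ≗ c ·ₛ (f *ₛ g)
  ·ₛ-*ₛ c f g zero    = ℤP.*-assoc c (f 0) (g 0)
  ·ₛ-*ₛ c f g (suc m) =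
    trans (cong₂ _+_ (ℤP.*-assoc c (f 0) (g (suc m))) (·ₛ-*ₛ c (tailₛ f) g m))
          (sym (ℤP.*-distribˡ-+ c _ _))

  *ₛ-suc : ∀ f g m → (f *ₛ g) (suc m) ≡ (f *ₛ tailₛ g) m + f (suc m) * g 0
  *ₛ-suc f g zero    = refl
  *ₛ-suc f g (suc m) =
    trans (cong (_+_ (f 0 * g (suc (suc m)))) (*ₛ-suc (tailₛ f) g m))
          (sym (ℤP.+-assoc (f 0 * g (suc (suc m))) ((tailₛ f *ₛ tailₛ g) m) (f (suc (suc m)) * g 0)))

  *ₛ-comm : ∀ f g → f *ₛ g ≗ g *ₛ f
  *ₛ-comm f g zero    = ℤP.*-comm (f 0) (g 0)
  *ₛ-comm f g (suc m) =
    trans (*ₛ-suc f g m)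
          (trans (cong₂ _+_ (*ₛ-comm f (tailₛ g) m) (ℤP.*-comm (f (suc m)) (g 0)))
           (ℤP.+-comm ((tailₛ g *ₛ f) m) (g 0 * f (suc m))))

  *ₛ-distribˡ : ∀ f g g′ → f *ₛ (g +ₛ g′) ≗ f *ₛ g +ₛ f *ₛ g′
  *ₛ-distribˡ f g g′ m = begin
    (f *ₛ (g +ₛ g′)) m         ≡⟨ *ₛ-comm f (g +ₛ g′) m ⟩
    ((g +ₛ g′) *ₛ f) m         ≡⟨ *ₛ-distribʳ g g′ f m ⟩
    (g *ₛ f) m + (g′ *ₛ f) m   ≡⟨ cong₂ _+_ (*ₛ-comm g f m) (*ₛ-comm g′ f m) ⟩
    (f *ₛ g) m + (f *ₛ g′) m   ∎
    where open ≡-Reasoning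

  *ₛ-assoc : ∀ f g h → (f *ₛ g) *ₛ h ≗ f *ₛ (g *ₛ h)
  *ₛ-assoc f g h zero    = ℤP.*-assoc (f 0) (g 0) (h 0)
  *ₛ-assoc f g h (suc m) = begin
    f 0 * g 0 * h (suc m) + (tailₛ (f *ₛ g) *ₛ h) m
      ≡⟨ cong (_+_ (f 0 * g 0 * h (suc m))) (*ₛ-distribʳ (f 0 ·ₛ tailₛ g) (tailₛ f *ₛ g) h m) ⟩
    f 0 * g 0 * h (suc m) + (((f 0 ·ₛ tailₛ g) *ₛ h) m + ((tailₛ f *ₛ g) *ₛ h) m)
      ≡⟨ cong (_+_ (f 0 * g 0 * h (suc m))) (cong₂ _+_ (·ₛ-*ₛ (f 0) (tailₛ g) h m) (*ₛ-assoc (tailₛ f) g h m)) ⟩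
    f 0 * g 0 * h (suc m) + (f 0 * (tailₛ g *ₛ h) m + (tailₛ f *ₛ (g *ₛ h)) m)
      ≡⟨ regroup (f 0) (g 0) (h (suc m)) _ _ ⟩
    f 0 * (g 0 * h (suc m) + (tailₛ g *ₛ h) m) + (tailₛ f *ₛ (g *ₛ h)) m ∎
    where
    open ≡-Reasoning
    regroup : ∀ a b c d e → a * b * c + (a * d + e) ≡ a * (b * c + d) + e
    regroup = solve-∀

  *ₛ-identityʳ : ∀ f → f *ₛ 1ₛ ≗ f
  *ₛ-identityʳ f m = trans (*ₛ-comm f 1ₛ m) (*ₛ-identityˡ f m)

  *ₛ-zeroʳ : ∀ f → f *ₛ 0ₛ ≗ 0ₛ
  *ₛ-zeroʳ f m = trans (*ₛ-comm f 0ₛ m) (*ₛ-zeroˡ f m)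

  *ₛ-1ₛ-commutativeMonoid : CommutativeMonoid 0ℓ 0ℓ
  *ₛ-1ₛ-commutativeMonoid = record
    { Carrier             = Series
    ; _≈_                 = _≗_
    ; _∙_                 = _*ₛ_
    ; ε                   = 1ₛ
    ; isCommutativeMonoid = record
      { isMonoid = record
        { isSemigroup = record
          { isMagma = record
            { isEquivalence = Setoid.isEquivalence (ℕ →-setoid ℤ)
            ; ∙-cong        = *ₛ-cong
            }
          ; assoc = *ₛ-assoc
          }
        ; identity = *ₛ-identityˡ , *ₛ-identityʳ
        }
      ; comm = *ₛ-comm
      }
    }

  open CommutativeSemigroupProperties (CommutativeMonoid.commutativeSemigroup *ₛ-1ₛ-commutativeMonoid)
    using (interchange; xy∙z≈y∙xz)

  shift-cong : ∀ k {f g} → f ≗ g → shift k f ≗ shift k g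
  shift-cong zero    f≗g m       = f≗g m
  shift-cong (suc k) f≗g zero    = refl
  shift-cong (suc k) f≗g (suc m) = shift-cong k f≗g m

  shift-0ₛ : ∀ k → shift k 0ₛ ≗ 0ₛ
  shift-0ₛ zero    m       = refl
  shift-0ₛ (suc k) zero    = refl
  shift-0ₛ (suc k) (suc m) = shift-0ₛ k m

  shift-+ₛ : ∀ k f g → shift k (f +ₛ g) ≗ shift k f +ₛ shift k g
  shift-+ₛ zero    f g m       = refl
  shift-+ₛ (suc k) f g zero    = refl
  shift-+ₛ (suc k) f g (suc m) = shift-+ₛ k f g m

  shift-·ₛ : ∀ k c f → shift k (c ·ₛ f) ≗ c ·ₛ shift k f
  shift-·ₛ zero    c f m       = refl
  shift-·ₛ (suc k) c f zero    = sym (ℤP.*-zeroʳ c)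
  shift-·ₛ (suc k) c f (suc m) = shift-·ₛ k c f m

  shift-shift : ∀ a b f → shift a (shift b f) ≗ shift (a ℕ.+ b) f
  shift-shift zero    b f m       = refl
  shift-shift (suc a) b f zero    = refl
  shift-shift (suc a) b f (suc m) = shift-shift a b f m

  shift-*ₛ : ∀ k f g → shift k f *ₛ g ≗ shift k (f *ₛ g)
  shift-*ₛ zero    f g m       = refl
  shift-*ₛ (suc k) f g zero    = refl
  shift-*ₛ (suc k) f g (suc m) = trans (ℤP.+-identityˡ _) (shift-*ₛ k f g m)

  shift-+ : ∀ a f i → shift a f (a ℕ.+ i) ≡ f i
  shift-+ zero    f i = refl
  shift-+ (suc a) f i = shift-+ a f i

  shift-< : ∀ a f k → k < a → shift a f k ≡ + 0
  shift-< (suc a) f zero    _         = refl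
  shift-< (suc a) f (suc k) (s≤s k<a) = shift-< a f k k<a

  ∑<-*ₛ : ∀ N (F : ℕ → Series) g m → ((λ m → ∑< N (λ j → F j m)) *ₛ g) m ≡ ∑< N (λ j → (F j *ₛ g) m)
  ∑<-*ₛ N F g m = begin
    ((λ m → ∑< N (λ j → F j m)) *ₛ g) m
      ≡⟨ *ₛ-coeff _ g m ⟩
    ∑< (suc m) (λ k → ∑< N (λ j → F j k) * g (m ∸ k))
      ≡⟨ ∑<-cong (suc m) (λ k → ∑<-*ʳ N (g (m ∸ k)) (λ j → F j k)) ⟩
    ∑< (suc m) (λ k → ∑< N (λ j → F j k * g (m ∸ k)))
      ≡⟨ ∑<-comm (suc m) N (λ k j → F j k * g (m ∸ k)) ⟩
    ∑< N (λ j → ∑< (suc m) (λ k → F j k * g (m ∸ k)))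
      ≡⟨ ∑<-cong N (λ j → *ₛ-coeff (F j) g m) ⟨
    ∑< N (λ j → (F j *ₛ g) m) ∎
    where open ≡-Reasoning

  shift-∑< : ∀ k N (F : ℕ → Series) → shift k (λ m → ∑< N (λ j → F j m)) ≗ (λ m → ∑< N (λ j → shift k (F j) m))
  shift-∑< k zero    F = shift-0ₛ k
  shift-∑< k (suc N) F m =
    trans (shift-+ₛ k (F 0) _ m) (cong (_+_ (shift k (F 0) m)) (shift-∑< k N (F ∘ suc) m))

  [_]q : ℕ → Series
  [ zero  ]q m       = + 0
  [ suc k ]q zero    = + 1
  [ suc k ]q (suc m) = [ k ]q m

  [_]q! : ℕ → Series
  [ zero  ]q! = 1ₛ
  [ suc n ]q! = [ n ]q! *ₛ [ suc n ]q

  geometric : Series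
  geometric _ = + 1

  geometric^ : ℕ → Series
  geometric^ zero    = 1ₛ
  geometric^ (suc n) = geometric^ n *ₛ geometric

  1-q^ : ℕ → Series
  1-q^ i = 1ₛ +ₛ - (+ 1) ·ₛ shift i 1ₛ

  qPochhammer : ℕ → Series
  qPochhammer zero    = 1ₛ
  qPochhammer (suc n) = qPochhammer n *ₛ 1-q^ (suc n)

  *ₛ-geometric : ∀ f m → (f *ₛ geometric) m ≡ ∑< (suc m) f
  *ₛ-geometric f m = trans (*ₛ-coeff f geometric m) (∑<-cong (suc m) (λ i → ℤP.*-identityʳ (f i)))

  *ₛ-1-q^ : ∀ i f → f *ₛ 1-q^ i ≗ f +ₛ - (+ 1) ·ₛ shift i f
  *ₛ-1-q^ i f = begin
    f *ₛ (1ₛ +ₛ - (+ 1) ·ₛ shift i 1ₛ)        ≈⟨ *ₛ-distribˡ f 1ₛ _ ⟩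
    f *ₛ 1ₛ +ₛ f *ₛ (- (+ 1) ·ₛ shift i 1ₛ)   ≈⟨ +ₛ-cong (*ₛ-identityʳ f) (*ₛ-comm f _) ⟩
    f +ₛ (- (+ 1) ·ₛ shift i 1ₛ) *ₛ f         ≈⟨ +ₛ-congʳ f (·ₛ-*ₛ (- (+ 1)) (shift i 1ₛ) f) ⟩
    f +ₛ - (+ 1) ·ₛ (shift i 1ₛ *ₛ f)         ≈⟨ +ₛ-congʳ f (·ₛ-congʳ (- (+ 1)) (shift-*ₛ i 1ₛ f)) ⟩
    f +ₛ - (+ 1) ·ₛ shift i (1ₛ *ₛ f)         ≈⟨ +ₛ-congʳ f (·ₛ-congʳ (- (+ 1)) (shift-cong i (*ₛ-identityˡ f))) ⟩
    f +ₛ - (+ 1) ·ₛ shift i f                 ∎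
    where open ≗-Reasoning

  geometric-shift : ∀ i → geometric +ₛ - (+ 1) ·ₛ shift i geometric ≗ [ i ]q
  geometric-shift zero    m       = refl
  geometric-shift (suc i) zero    = refl
  geometric-shift (suc i) (suc m) = geometric-shift i m

  1-q^*geometric : ∀ i → 1-q^ i *ₛ geometric ≗ [ i ]q
  1-q^*geometric i = begin
    1-q^ i *ₛ geometric                       ≈⟨ *ₛ-comm (1-q^ i) geometric ⟩
    geometric *ₛ 1-q^ i                       ≈⟨ *ₛ-1-q^ i geometric ⟩
    geometric +ₛ - (+ 1) ·ₛ shift i geometric ≈⟨ geometric-shift i ⟩
    [ i ]q                                    ∎
    where open ≗-Reasoning

  qPochhammer*geometric^ : ∀ n → qPochhammer n *ₛ geometric^ n ≗ [ n ]q!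
  qPochhammer*geometric^ zero    = *ₛ-identityˡ 1ₛ
  qPochhammer*geometric^ (suc n) = begin
    (qPochhammer n *ₛ 1-q^ (suc n)) *ₛ (geometric^ n *ₛ geometric)
      ≈⟨ interchange (qPochhammer n) (1-q^ (suc n)) (geometric^ n) geometric ⟩
    (qPochhammer n *ₛ geometric^ n) *ₛ (1-q^ (suc n) *ₛ geometric)
      ≈⟨ *ₛ-cong (qPochhammer*geometric^ n) (1-q^*geometric (suc n)) ⟩
    [ n ]q! *ₛ [ suc n ]q ∎
    where open ≗-Reasoning

  hockeyStick : ∀ n m → ∑< (suc m) (λ i → + ((i ℕ.+ n) C n)) ≡ + ((m ℕ.+ suc n) C suc n)
  hockeyStick n zero    = trans (ℤP.+-identityʳ _) (cong +_ (trans (nCn≡1 n) (sym (nCn≡1 (suc n)))))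
  hockeyStick n (suc m) = begin
    ∑< (suc (suc m)) F                                  ≡⟨ ∑<-last (suc m) F ⟩
    ∑< (suc m) F + F (suc m)                            ≡⟨ cong (_+ F (suc m)) (hockeyStick n m) ⟩
    + ((m ℕ.+ suc n) C suc n) + + ((suc m ℕ.+ n) C n)  ≡⟨ cong (λ a → + ((m ℕ.+ suc n) C suc n) + + (a C n)) (sym (ℕP.+-suc m n)) ⟩
    + ((m ℕ.+ suc n) C suc n ℕ.+ (m ℕ.+ suc n) C n)    ≡⟨ cong +_ (ℕP.+-comm ((m ℕ.+ suc n) C suc n) _) ⟩
    + ((m ℕ.+ suc n) C n ℕ.+ (m ℕ.+ suc n) C suc n)    ≡⟨ cong +_ (nCk+nC[k+1]≡[n+1]C[k+1] (m ℕ.+ suc n) n) ⟩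
    + (suc (m ℕ.+ suc n) C suc n)                       ∎
    where
    open ≡-Reasoning
    F : ℕ → ℤ
    F i = + ((i ℕ.+ n) C n)

  geometric^-coeff : ∀ n m → geometric^ (suc n) m ≡ + ((m ℕ.+ n) C n)
  geometric^-coeff zero    m = *ₛ-identityˡ geometric m
  geometric^-coeff (suc n) m = begin
    (geometric^ (suc n) *ₛ geometric) m         ≡⟨ *ₛ-geometric (geometric^ (suc n)) m ⟩
    ∑< (suc m) (geometric^ (suc n))             ≡⟨ ∑<-cong (suc m) (geometric^-coeff n) ⟩
    ∑< (suc m) (λ i → + ((i ℕ.+ n) C n))        ≡⟨ hockeyStick n m ⟩
    + ((m ℕ.+ suc n) C suc n)                   ∎
    where open ≡-Reasoning

  [_]q*ₛ : ∀ N f s → ([ N ]q *ₛ f) s ≡ ∑< N (λ r → shift r f s)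
  [ zero  ]q*ₛ f s       = *ₛ-zeroˡ f s
  [ suc N ]q*ₛ f zero    =
    trans (ℤP.*-identityˡ (f 0))
          (sym (trans (cong (_+_ (f 0)) (∑<-zero N (λ r _ → refl))) (ℤP.+-identityʳ (f 0))))
  [ suc N ]q*ₛ f (suc s) =
    cong₂ _+_ (ℤP.*-identityˡ (f (suc s))) ([ N ]q*ₛ f s)

  -- Gaussian polynomials and the q-binomial theorem

  qBinomial : ℕ → ℕ → Series
  qBinomial n       zero    = 1ₛ
  qBinomial zero    (suc j) = 0ₛ
  qBinomial (suc n) (suc j) = shift (n ∸ j) (qBinomial n j) +ₛ qBinomial n (suc j)

  qBinomial-vanish : ∀ {n j} → n ≤ j → qBinomial n (suc j) ≗ 0ₛ
  qBinomial-vanish {zero}           _         m = refl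
  qBinomial-vanish {suc n} {suc j} (s≤s n≤j) m = begin
    shift (n ∸ suc j) (qBinomial n (suc j)) m + qBinomial n (suc (suc j)) m
      ≡⟨ cong₂ _+_ (shift-cong (n ∸ suc j) (qBinomial-vanish n≤j) m) (qBinomial-vanish (ℕP.m≤n⇒m≤1+n n≤j) m) ⟩
    shift (n ∸ suc j) 0ₛ m + + 0
      ≡⟨ cong (_+ + 0) (shift-0ₛ (n ∸ suc j) m) ⟩
    + 0 ∎
    where open ≡-Reasoning

  [_]q-+ : ∀ a b → shift a [ b ]q +ₛ [ a ]q ≗ [ a ℕ.+ b ]q
  [ zero  ]q-+ b m       = ℤP.+-identityʳ ([ b ]q m)
  [ suc a ]q-+ b zero    = refl
  [ suc a ]q-+ b (suc m) = [ a ]q-+ b m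

  qBinomial-qfactorial : ∀ j k → [ j ]q! *ₛ [ k ]q! *ₛ qBinomial (j ℕ.+ k) j ≗ [ j ℕ.+ k ]q!
  qBinomial-qfactorial zero    k = begin
    1ₛ *ₛ [ k ]q! *ₛ 1ₛ  ≈⟨ *ₛ-identityʳ (1ₛ *ₛ [ k ]q!) ⟩
    1ₛ *ₛ [ k ]q!        ≈⟨ *ₛ-identityˡ [ k ]q! ⟩
    [ k ]q!              ∎
    where open ≗-Reasoning
  qBinomial-qfactorial (suc j) k = begin
    X *ₛ (shift ((j ℕ.+ k) ∸ j) (qBinomial (j ℕ.+ k) j) +ₛ qBinomial (j ℕ.+ k) (suc j))
      ≈⟨ *ₛ-distribˡ X _ _ ⟩
    X *ₛ shift ((j ℕ.+ k) ∸ j) (qBinomial (j ℕ.+ k) j) +ₛ X *ₛ qBinomial (j ℕ.+ k) (suc j)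
      ≈⟨ +ₛ-cong pascalˡ (pascalʳ k) ⟩
    shift k [ suc j ]q *ₛ [ j ℕ.+ k ]q! +ₛ [ k ]q *ₛ [ j ℕ.+ k ]q!
      ≈⟨ *ₛ-distribʳ (shift k [ suc j ]q) [ k ]q [ j ℕ.+ k ]q! ⟨
    (shift k [ suc j ]q +ₛ [ k ]q) *ₛ [ j ℕ.+ k ]q!
      ≈⟨ *ₛ-congˡ [ j ℕ.+ k ]q! ([ k ]q-+ (suc j)) ⟩
    [ k ℕ.+ suc j ]q *ₛ [ j ℕ.+ k ]q!
      ≈⟨ *ₛ-congˡ [ j ℕ.+ k ]q! (λ m → cong (λ a → [ a ]q m) (trans (ℕP.+-suc k j) (cong suc (ℕP.+-comm k j)))) ⟩
    [ suc (j ℕ.+ k) ]q *ₛ [ j ℕ.+ k ]q!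
      ≈⟨ *ₛ-comm [ suc (j ℕ.+ k) ]q [ j ℕ.+ k ]q! ⟩
    [ suc (j ℕ.+ k) ]q! ∎
    where
    open ≗-Reasoning
    X : Series
    X = [ suc j ]q! *ₛ [ k ]q!

    pascalˡ : X *ₛ shift ((j ℕ.+ k) ∸ j) (qBinomial (j ℕ.+ k) j) ≗ shift k [ suc j ]q *ₛ [ j ℕ.+ k ]q!
    pascalˡ = begin
      X *ₛ shift ((j ℕ.+ k) ∸ j) (qBinomial (j ℕ.+ k) j)
        ≈⟨ *ₛ-congʳ X (λ m → cong (λ a → shift a (qBinomial (j ℕ.+ k) j) m) (ℕP.m+n∸m≡n j k)) ⟩
      X *ₛ shift k (qBinomial (j ℕ.+ k) j)
        ≈⟨ *ₛ-comm X _ ⟩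
      shift k (qBinomial (j ℕ.+ k) j) *ₛ X
        ≈⟨ shift-*ₛ k _ X ⟩
      shift k (qBinomial (j ℕ.+ k) j *ₛ X)
        ≈⟨ shift-cong k (*ₛ-comm _ X) ⟩
      shift k (([ j ]q! *ₛ [ suc j ]q) *ₛ [ k ]q! *ₛ qBinomial (j ℕ.+ k) j)
        ≈⟨ shift-cong k (*ₛ-congˡ (qBinomial (j ℕ.+ k) j) (xy∙z≈y∙xz [ j ]q! [ suc j ]q [ k ]q!)) ⟩
      shift k ([ suc j ]q *ₛ ([ j ]q! *ₛ [ k ]q!) *ₛ qBinomial (j ℕ.+ k) j)
        ≈⟨ shift-cong k (*ₛ-assoc [ suc j ]q _ _) ⟩
      shift k ([ suc j ]q *ₛ ([ j ]q! *ₛ [ k ]q! *ₛ qBinomial (j ℕ.+ k) j))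
        ≈⟨ shift-cong k (*ₛ-congʳ [ suc j ]q (qBinomial-qfactorial j k)) ⟩
      shift k ([ suc j ]q *ₛ [ j ℕ.+ k ]q!)
        ≈⟨ shift-*ₛ k [ suc j ]q [ j ℕ.+ k ]q! ⟨
      shift k [ suc j ]q *ₛ [ j ℕ.+ k ]q! ∎

    pascalʳ : ∀ l → [ suc j ]q! *ₛ [ l ]q! *ₛ qBinomial (j ℕ.+ l) (suc j) ≗ [ l ]q *ₛ [ j ℕ.+ l ]q!
    pascalʳ zero m = trans
      (*ₛ-congʳ ([ suc j ]q! *ₛ 1ₛ) (qBinomial-vanish (ℕP.≤-reflexive (ℕP.+-identityʳ j))) m)
      (trans (*ₛ-zeroʳ _ m) (sym (*ₛ-zeroˡ [ j ℕ.+ 0 ]q! m)))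
    pascalʳ (suc l) = begin
      [ suc j ]q! *ₛ ([ l ]q! *ₛ [ suc l ]q) *ₛ qBinomial (j ℕ.+ suc l) (suc j)
        ≈⟨ *ₛ-congʳ _ (λ m → cong (λ a → qBinomial a (suc j) m) (ℕP.+-suc j l)) ⟩
      [ suc j ]q! *ₛ ([ l ]q! *ₛ [ suc l ]q) *ₛ qBinomial (suc j ℕ.+ l) (suc j)
        ≈⟨ *ₛ-congˡ _ (*ₛ-assoc [ suc j ]q! [ l ]q! [ suc l ]q) ⟨
      [ suc j ]q! *ₛ [ l ]q! *ₛ [ suc l ]q *ₛ qBinomial (suc j ℕ.+ l) (suc j)
        ≈⟨ *ₛ-congˡ _ (*ₛ-comm ([ suc j ]q! *ₛ [ l ]q!) [ suc l ]q) ⟩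
      [ suc l ]q *ₛ ([ suc j ]q! *ₛ [ l ]q!) *ₛ qBinomial (suc j ℕ.+ l) (suc j)
        ≈⟨ *ₛ-assoc [ suc l ]q _ _ ⟩
      [ suc l ]q *ₛ ([ suc j ]q! *ₛ [ l ]q! *ₛ qBinomial (suc j ℕ.+ l) (suc j))
        ≈⟨ *ₛ-congʳ [ suc l ]q (qBinomial-qfactorial (suc j) l) ⟩
      [ suc l ]q *ₛ [ suc j ℕ.+ l ]q!
        ≈⟨ *ₛ-congʳ [ suc l ]q (λ m → cong (λ a → [ a ]q! m) (sym (ℕP.+-suc j l))) ⟩
      [ suc l ]q *ₛ [ j ℕ.+ suc l ]q! ∎

  triangular : ℕ → ℕ
  triangular zero    = 0
  triangular (suc j) = suc j ℕ.+ triangular j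

  qBinomialTerm : ℕ → ℕ → Series
  qBinomialTerm n j = (- (+ 1)) ^ j ·ₛ shift (triangular j) (qBinomial n j)

  qBinomialTerm-vanish : ∀ {n j} → n ≤ j → qBinomialTerm n (suc j) ≗ 0ₛ
  qBinomialTerm-vanish {n} {j} n≤j m = begin
    (- (+ 1)) ^ suc j * shift (triangular (suc j)) (qBinomial n (suc j)) m
      ≡⟨ cong ((- (+ 1)) ^ suc j *_) (shift-cong (triangular (suc j)) (qBinomial-vanish n≤j) m) ⟩
    (- (+ 1)) ^ suc j * shift (triangular (suc j)) 0ₛ m
      ≡⟨ cong ((- (+ 1)) ^ suc j *_) (shift-0ₛ (triangular (suc j)) m) ⟩
    (- (+ 1)) ^ suc j * + 0
      ≡⟨ ℤP.*-zeroʳ ((- (+ 1)) ^ suc j) ⟩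
    + 0 ∎
    where open ≡-Reasoning

  triangular-suc : ∀ {n j} → j ≤ n → triangular (suc j) ℕ.+ (n ∸ j) ≡ suc n ℕ.+ triangular j
  triangular-suc {n} {j} j≤n = begin
    suc j ℕ.+ triangular j ℕ.+ (n ∸ j)   ≡⟨ rearrange j (triangular j) (n ∸ j) ⟩
    suc (j ℕ.+ (n ∸ j)) ℕ.+ triangular j ≡⟨ cong (λ a → suc a ℕ.+ triangular j) (ℕP.m+[n∸m]≡n j≤n) ⟩
    suc n ℕ.+ triangular j               ∎
    where
    open ≡-Reasoning
    rearrange : ∀ a b c → suc a ℕ.+ b ℕ.+ c ≡ suc (a ℕ.+ c) ℕ.+ b
    rearrange = ℕSolver.solve-∀

  qBinomialTerm-pascal : ∀ {n j} → j ≤ n →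
    qBinomialTerm (suc n) (suc j) ≗ qBinomialTerm n (suc j) +ₛ - (+ 1) ·ₛ shift (suc n) (qBinomialTerm n j)
  qBinomialTerm-pascal {n} {j} j≤n m = begin
    sgn * shift (triangular (suc j)) (shift (n ∸ j) G +ₛ G′) m
      ≡⟨ cong (sgn *_) (shift-+ₛ (triangular (suc j)) _ G′ m) ⟩
    sgn * (shift (triangular (suc j)) (shift (n ∸ j) G) m + shift (triangular (suc j)) G′ m)
      ≡⟨ cong (λ a → sgn * (a + shift (triangular (suc j)) G′ m)) exponent ⟩
    sgn * (shift (suc n) (shift (triangular j) G) m + shift (triangular (suc j)) G′ m)
      ≡⟨ signs ((- (+ 1)) ^ j) (shift (suc n) (shift (triangular j) G) m) (shift (triangular (suc j)) G′ m) ⟩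
    sgn * shift (triangular (suc j)) G′ m + - (+ 1) * ((- (+ 1)) ^ j * shift (suc n) (shift (triangular j) G) m)
      ≡⟨ cong (λ a → sgn * shift (triangular (suc j)) G′ m + - (+ 1) * a)
              (sym (shift-·ₛ (suc n) ((- (+ 1)) ^ j) (shift (triangular j) G) m)) ⟩
    qBinomialTerm n (suc j) m + - (+ 1) * shift (suc n) (qBinomialTerm n j) m ∎
    where
    open ≡-Reasoning
    sgn : ℤ
    sgn = (- (+ 1)) ^ suc j
    G G′ : Series
    G  = qBinomial n j
    G′ = qBinomial n (suc j)
    exponent : shift (triangular (suc j)) (shift (n ∸ j) G) m ≡ shift (suc n) (shift (triangular j) G) m
    exponent = begin
      shift (triangular (suc j)) (shift (n ∸ j) G) m    ≡⟨ shift-shift (triangular (suc j)) (n ∸ j) G m ⟩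
      shift (triangular (suc j) ℕ.+ (n ∸ j)) G m        ≡⟨ cong (λ a → shift a G m) (triangular-suc j≤n) ⟩
      shift (suc n ℕ.+ triangular j) G m                ≡⟨ shift-shift (suc n) (triangular j) G m ⟨
      shift (suc n) (shift (triangular j) G) m          ∎
    signs : ∀ s a b → (- (+ 1) * s) * (a + b) ≡ (- (+ 1) * s) * b + - (+ 1) * (s * a)
    signs = solve-∀

  qBinomialTheorem : ∀ n → qPochhammer n ≗ (λ m → ∑< (suc n) (λ j → qBinomialTerm n j m))
  qBinomialTheorem zero    m = sym (trans (ℤP.+-identityʳ (qBinomialTerm 0 0 m)) (ℤP.*-identityˡ (1ₛ m)))
  qBinomialTheorem (suc n) m = begin
    (qPochhammer n *ₛ 1-q^ (suc n)) m
      ≡⟨ *ₛ-1-q^ (suc n) (qPochhammer n) m ⟩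
    qPochhammer n m + - (+ 1) * shift (suc n) (qPochhammer n) m
      ≡⟨ cong₂ (λ a b → a + - (+ 1) * b) (qBinomialTheorem n m)
               (trans (shift-cong (suc n) (qBinomialTheorem n) m) (shift-∑< (suc n) (suc n) E m)) ⟩
    ∑< (suc n) (λ j → E j m) + - (+ 1) * ∑< (suc n) (λ j → shift (suc n) (E j) m)
      ≡⟨ cong₂ _+_ dropTop (∑<-*ˡ (suc n) (- (+ 1)) (λ j → shift (suc n) (E j) m)) ⟩
    (E 0 m + ∑< (suc n) (λ j → E (suc j) m)) + ∑< (suc n) (λ j → - (+ 1) * shift (suc n) (E j) m)
      ≡⟨ ℤP.+-assoc (E 0 m) _ _ ⟩
    E 0 m + (∑< (suc n) (λ j → E (suc j) m) + ∑< (suc n) (λ j → - (+ 1) * shift (suc n) (E j) m))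
      ≡⟨ cong (_+_ (E 0 m)) (sym (∑<-+ (suc n) (λ j → E (suc j) m) (λ j → - (+ 1) * shift (suc n) (E j) m))) ⟩
    E 0 m + ∑< (suc n) (λ j → E (suc j) m + - (+ 1) * shift (suc n) (E j) m)
      ≡⟨ cong (_+_ (E 0 m)) (∑<-cong-< (suc n) (λ j j<1+n → sym (qBinomialTerm-pascal {n} {j} (ℕP.≤-pred j<1+n) m))) ⟩
    ∑< (suc (suc n)) (λ j → qBinomialTerm (suc n) j m) ∎
    where
    open ≡-Reasoning
    E : ℕ → Series
    E = qBinomialTerm n
    dropTop : ∑< (suc n) (λ j → E j m) ≡ E 0 m + ∑< (suc n) (λ j → E (suc j) m)
    dropTop = cong (_+_ (E 0 m)) (begin
      ∑< n (λ j → E (suc j) m)                          ≡⟨ ℤP.+-identityʳ _ ⟨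
      ∑< n (λ j → E (suc j) m) + + 0                    ≡⟨ cong (_+_ (∑< n (λ j → E (suc j) m))) (qBinomialTerm-vanish {n} ℕP.≤-refl m) ⟨
      ∑< n (λ j → E (suc j) m) + E (suc n) m            ≡⟨ ∑<-last n (λ j → E (suc j) m) ⟨
      ∑< (suc n) (λ j → E (suc j) m)                    ∎)

  triangular≡C : ∀ j → (j ℕ.+ 1) C 2 ≡ triangular j
  triangular≡C zero    = refl
  triangular≡C (suc j) = begin
    suc (j ℕ.+ 1) C 2                         ≡⟨ nCk+nC[k+1]≡[n+1]C[k+1] (j ℕ.+ 1) 1 ⟨
    (j ℕ.+ 1) C 1 ℕ.+ (j ℕ.+ 1) C 2           ≡⟨ cong₂ ℕ._+_ (trans (nC1≡n (j ℕ.+ 1)) (ℕP.+-comm j 1)) (triangular≡C j) ⟩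
    suc j ℕ.+ triangular j                    ∎
    where open ≡-Reasoning

  triangular-mono : ∀ {j n} → j ≤ n → triangular j ≤ triangular n
  triangular-mono z≤n       = z≤n
  triangular-mono (s≤s j≤n) = ℕP.+-mono-≤ (s≤s j≤n) (triangular-mono j≤n)

  C2≤triangular : ∀ n → n C 2 ≤ triangular n
  C2≤triangular n = begin
    n C 2                    ≤⟨ ℕP.m≤n+m (n C 2) (n C 1) ⟩
    n C 1 ℕ.+ n C 2          ≡⟨ nCk+nC[k+1]≡[n+1]C[k+1] n 1 ⟩
    suc n C 2                ≡⟨ cong (_C 2) (ℕP.+-comm 1 n) ⟩
    (n ℕ.+ 1) C 2            ≡⟨ triangular≡C n ⟩
    triangular n             ∎
    where open ℕP.≤-Reasoning

  coeff-⊕ : ∀ p q → coeff (p ⊕ q) ≗ coeff p +ₛ coeff q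
  coeff-⊕ []      q       m       = sym (ℤP.+-identityˡ _)
  coeff-⊕ (a ∷ p) []      m       = sym (ℤP.+-identityʳ _)
  coeff-⊕ (a ∷ p) (b ∷ q) zero    = refl
  coeff-⊕ (a ∷ p) (b ∷ q) (suc m) = coeff-⊕ p q m

  coeff-scale : ∀ a q → coeff (scale a q) ≗ a ·ₛ coeff q
  coeff-scale a []      m       = sym (ℤP.*-zeroʳ a)
  coeff-scale a (b ∷ q) zero    = refl
  coeff-scale a (b ∷ q) (suc m) = coeff-scale a q m

  coeff-⊗ : ∀ p q → coeff (p ⊗ q) ≗ coeff p *ₛ coeff q
  coeff-⊗ []      q m       = sym (*ₛ-zeroˡ (coeff q) m)
  coeff-⊗ (a ∷ p) q zero    =
    trans (coeff-⊕ (scale a q) (+ 0 ∷ p ⊗ q) zero) (trans (ℤP.+-identityʳ _) (coeff-scale a q zero))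
  coeff-⊗ (a ∷ p) q (suc m) =
    trans (coeff-⊕ (scale a q) (+ 0 ∷ p ⊗ q) (suc m)) (cong₂ _+_ (coeff-scale a q (suc m)) (coeff-⊗ p q m))

  coeff-qint : ∀ k → coeff (qint k) ≗ [ k ]q
  coeff-qint zero    m       = refl
  coeff-qint (suc k) zero    = refl
  coeff-qint (suc k) (suc m) = coeff-qint k m

  coeff-qfact : ∀ n → coeff (qfact n) ≗ [ n ]q!
  coeff-qfact zero    zero    = refl
  coeff-qfact zero    (suc m) = refl
  coeff-qfact (suc n) = begin
    coeff (qfact n ⊗ qint (suc n))           ≈⟨ coeff-⊗ (qfact n) (qint (suc n)) ⟩
    coeff (qfact n) *ₛ coeff (qint (suc n))  ≈⟨ *ₛ-cong (coeff-qfact n) (coeff-qint (suc n)) ⟩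
    [ n ]q! *ₛ [ suc n ]q                    ∎
    where open ≗-Reasoning

  [_]q!-constant : ∀ n → [ n ]q! 0 ≡ + 1
  [ zero  ]q!-constant = refl
  [ suc n ]q!-constant = trans (ℤP.*-identityʳ ([ n ]q! 0)) [ n ]q!-constant

  sumℤ-zipWith : ∀ (f g : ℕ → ℤ) m →
    sumℤ (zipWith _*_ (applyUpTo f (suc m)) (applyDownFrom g (suc m))) ≡ ∑< (suc m) (λ i → f i * g (m ∸ i))
  sumℤ-zipWith f g zero    = refl
  sumℤ-zipWith f g (suc m) = cong (_+_ (f 0 * g (suc m))) (sumℤ-zipWith (f ∘ suc) g m)

  module _ (P Q : Poly) (R : Series) (Q₀≡1 : coeff Q 0 ≡ + 1) (P≗QR : coeff P ≗ coeff Q *ₛ R) where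

    private
      leading : ∀ m → coeff Q 0 * R m ≡ R m
      leading m = trans (cong (_* R m) Q₀≡1) (ℤP.*-identityˡ (R m))

    divCoeffs-correct : ∀ m → divCoeffs P Q m ≡ applyDownFrom R (suc m)
    divCoeffs-correct zero    = cong (_∷ []) (trans (P≗QR 0) (leading 0))
    divCoeffs-correct (suc m) rewrite divCoeffs-correct m = cong (_∷ applyDownFrom R (suc m)) (begin
      coeff P (suc m) - sumℤ (zipWith _*_ (map (coeff Q ∘ suc) (upTo (suc m))) (applyDownFrom R (suc m)))
        ≡⟨ cong₂ _-_ (trans (P≗QR (suc m)) (cong (_+ (tailₛ (coeff Q) *ₛ R) m) (leading (suc m))))
                      (cong (λ l → sumℤ (zipWith _*_ l (applyDownFrom R (suc m)))) (map-applyUpTo id (coeff Q ∘ suc) (suc m))) ⟩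
      R (suc m) + (tailₛ (coeff Q) *ₛ R) m - sumℤ (zipWith _*_ (applyUpTo (coeff Q ∘ suc) (suc m)) (applyDownFrom R (suc m)))
        ≡⟨ cong (λ a → R (suc m) + (tailₛ (coeff Q) *ₛ R) m - a)
                (trans (sumℤ-zipWith (coeff Q ∘ suc) R m) (sym (*ₛ-coeff (tailₛ (coeff Q)) R m))) ⟩
      R (suc m) + (tailₛ (coeff Q) *ₛ R) m - (tailₛ (coeff Q) *ₛ R) m
        ≡⟨ cancel (R (suc m)) _ ⟩
      R (suc m) ∎)
      where
      open ≡-Reasoning
      cancel : ∀ a b → a + b - b ≡ a
      cancel = solve-∀

    quotCoeff-correct : quotCoeff P Q ≗ R
    quotCoeff-correct m rewrite divCoeffs-correct m = refl

  gaussCoeff≗qBinomial : ∀ {n j} → j ≤ n → gaussCoeff n j ≗ qBinomial n j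
  gaussCoeff≗qBinomial {n} {j} j≤n = quotCoeff-correct (qfact n) Q (qBinomial n j) Q₀≡1 P≗QR
    where
    Q : Poly
    Q = qfact (n ∸ j) ⊗ qfact j
    coeffQ : coeff Q ≗ [ j ]q! *ₛ [ n ∸ j ]q!
    coeffQ = begin
      coeff Q                         ≈⟨ coeff-⊗ (qfact (n ∸ j)) (qfact j) ⟩
      coeff (qfact (n ∸ j)) *ₛ coeff (qfact j)  ≈⟨ *ₛ-cong (coeff-qfact (n ∸ j)) (coeff-qfact j) ⟩
      [ n ∸ j ]q! *ₛ [ j ]q!          ≈⟨ *ₛ-comm [ n ∸ j ]q! [ j ]q! ⟩
      [ j ]q! *ₛ [ n ∸ j ]q!          ∎
      where open ≗-Reasoning
    Q₀≡1 : coeff Q 0 ≡ + 1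
    Q₀≡1 = trans (coeffQ 0) (cong₂ _*_ [ j ]q!-constant [ n ∸ j ]q!-constant)
    P≗QR : coeff (qfact n) ≗ coeff Q *ₛ qBinomial n j
    P≗QR = begin
      coeff (qfact n)                              ≈⟨ coeff-qfact n ⟩
      [ n ]q!                                      ≈⟨ (λ m → cong (λ a → [ a ]q! m) (ℕP.m+[n∸m]≡n j≤n)) ⟨
      [ j ℕ.+ (n ∸ j) ]q!                          ≈⟨ qBinomial-qfactorial j (n ∸ j) ⟨
      [ j ]q! *ₛ [ n ∸ j ]q! *ₛ qBinomial (j ℕ.+ (n ∸ j)) j
        ≈⟨ *ₛ-congʳ _ (λ m → cong (λ a → qBinomial a j m) (ℕP.m+[n∸m]≡n j≤n)) ⟩
      [ j ]q! *ₛ [ n ∸ j ]q! *ₛ qBinomial n j      ≈⟨ *ₛ-congˡ (qBinomial n j) coeffQ ⟨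
      coeff Q *ₛ qBinomial n j                     ∎
      where open ≗-Reasoning

  -- Counting permutations by inversions

  ind : Bool → ℕ
  ind b = if b then 1 else 0

  q^ : ℕ → Series
  q^ e = shift e 1ₛ

  q^-coeff : ∀ e s → q^ e s ≡ + ind (e ℕ.≡ᵇ s)
  q^-coeff zero    zero    = refl
  q^-coeff zero    (suc s) = refl
  q^-coeff (suc e) zero    = refl
  q^-coeff (suc e) (suc s) = q^-coeff e s

  ΣL : ∀ {A : Set} → List A → (A → ℤ) → ℤ
  ΣL []      f = + 0
  ΣL (x ∷ L) f = f x + ΣL L f

  module _ {A : Set} where

    ΣL-cong : ∀ (L : List A) {f g} → f ≗ g → ΣL L f ≡ ΣL L g
    ΣL-cong []      f≗g = refl
    ΣL-cong (x ∷ L) f≗g = cong₂ _+_ (f≗g x) (ΣL-cong L f≗g)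

    ΣL-zero : ∀ (L : List A) → ΣL L (λ _ → + 0) ≡ + 0
    ΣL-zero []      = refl
    ΣL-zero (x ∷ L) = trans (ℤP.+-identityˡ _) (ΣL-zero L)

    ΣL-++ : ∀ (L L′ : List A) f → ΣL (L ++ L′) f ≡ ΣL L f + ΣL L′ f
    ΣL-++ []      L′ f = sym (ℤP.+-identityˡ _)
    ΣL-++ (x ∷ L) L′ f = trans (cong (_+_ (f x)) (ΣL-++ L L′ f)) (sym (ℤP.+-assoc (f x) _ _))

    ΣL-filter : ∀ (p : A → Bool) L f → ΣL (filter (T? ∘ p) L) f ≡ ΣL L (λ x → + ind (p x) * f x)
    ΣL-filter p []      f = refl
    ΣL-filter p (x ∷ L) f with p x
    ... | true  = cong₂ _+_ (sym (ℤP.*-identityˡ (f x))) (ΣL-filter p L f)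
    ... | false = trans (ΣL-filter p L f) (sym (ℤP.+-identityˡ _))

    length-ΣL : ∀ (L : List A) → + length L ≡ ΣL L (λ _ → + 1)
    length-ΣL []      = refl
    length-ΣL (x ∷ L) = trans (ℤP.pos-+ 1 (length L)) (cong (_+_ (+ 1)) (length-ΣL L))

    shift-ΣL : ∀ k (L : List A) (F : A → Series) → shift k (λ s → ΣL L (λ x → F x s)) ≗ (λ s → ΣL L (λ x → shift k (F x) s))
    shift-ΣL k []      F = shift-0ₛ k
    shift-ΣL k (x ∷ L) F s = trans (shift-+ₛ k (F x) _ s) (cong (_+_ (shift k (F x) s)) (shift-ΣL k L F s))

  ΣL-concatMap : ∀ {A B : Set} (g : A → List B) L f → ΣL (concatMap g L) f ≡ ΣL L (λ x → ΣL (g x) f)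
  ΣL-concatMap g []      f = refl
  ΣL-concatMap g (x ∷ L) f = trans (ΣL-++ (g x) (concatMap g L) f) (cong (_+_ (ΣL (g x) f)) (ΣL-concatMap g L f))

  ΣL-map : ∀ {A B : Set} (g : A → B) L f → ΣL (map g L) f ≡ ΣL L (f ∘ g)
  ΣL-map g []      f = refl
  ΣL-map g (x ∷ L) f = cong (_+_ (f (g x))) (ΣL-map g L f)

  ΣL-tabulate : ∀ {A : Set} m (g : Fin m → A) f → ΣL (tabulate g) f ≡ ℤΣ.sum (f ∘ g)
  ΣL-tabulate zero    g f = refl
  ΣL-tabulate (suc m) g f = cong (_+_ (f (g fzero))) (ΣL-tabulate m (g ∘ fsuc) f)

  ΣL-allWords : ∀ k m f → ΣL (allWords (suc k) m) f ≡ ℤΣ.sum (λ x → ΣL (allWords k m) (λ w → f (x ∷ w)))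
  ΣL-allWords k m f = begin
    ΣL (concatMap (λ x → map (x ∷_) (allWords k m)) (allFin m)) f
      ≡⟨ ΣL-concatMap (λ x → map (x ∷_) (allWords k m)) (allFin m) f ⟩
    ΣL (allFin m) (λ x → ΣL (map (x ∷_) (allWords k m)) f)
      ≡⟨ ΣL-tabulate m id _ ⟩
    ℤΣ.sum (λ x → ΣL (map (x ∷_) (allWords k m)) f)
      ≡⟨ ℤΣ.sum-cong-≗ {m} (λ x → ΣL-map (x ∷_) (allWords k m) f) ⟩
    ℤΣ.sum (λ x → ΣL (allWords k m) (λ w → f (x ∷ w))) ∎
    where open ≡-Reasoning

  Subset : ℕ → Set
  Subset m = Fin m → Bool

  module _ {m : ℕ} where

    ∣_∣ : Subset m → ℕ
    ∣ Q ∣ = ℕΣ.sum (ind ∘ Q)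

    _∩_ : Subset m → Subset m → Subset m
    (Q ∩ R) y = Q y ∧ R y

    _─_ : Subset m → Fin m → Subset m
    (Q ─ x) y = not (does (x ≟ y)) ∧ Q y

    below : Fin m → Subset m
    below x y = toℕ y <ᵇ toℕ x

    rank : Subset m → Fin m → ℕ
    rank Q x = ∣ below x ∩ Q ∣

    ∣∣-cong : ∀ {Q R : Subset m} → Q ≗ R → ∣ Q ∣ ≡ ∣ R ∣
    ∣∣-cong Q≗R = ℕΣ.sum-cong-≗ {m} (cong ind ∘ Q≗R)

    -- the letters of w are distinct and lie in Q: for k = ∣ Q ∣, an ordering of Q
    isArrangement : ∀ {k} → Subset m → Vec (Fin m) k → Bool
    isArrangement Q []      = true
    isArrangement Q (x ∷ w) = Q x ∧ isArrangement (Q ─ x) w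

    arrangementSeries : ℕ → Subset m → Series
    arrangementSeries k Q s = ΣL (allWords k m) (λ w → + ind (isArrangement Q w) * q^ (inversions w) s)

  ∣∣-remove : ∀ {m} (Q : Subset m) x → ∣ Q ∣ ≡ ind (Q x) ℕ.+ ∣ Q ─ x ∣
  ∣∣-remove {suc m} Q fzero    = refl
  ∣∣-remove {suc m} Q (fsuc x) = begin
    ind (Q fzero) ℕ.+ ∣ Q ∘ fsuc ∣                             ≡⟨ cong (ind (Q fzero) ℕ.+_) (∣∣-remove (Q ∘ fsuc) x) ⟩
    ind (Q fzero) ℕ.+ (ind (Q (fsuc x)) ℕ.+ ∣ (Q ∘ fsuc) ─ x ∣) ≡⟨ x+yz≡y+xz (ind (Q fzero)) (ind (Q (fsuc x))) _ ⟩
    ind (Q (fsuc x)) ℕ.+ (ind (Q fzero) ℕ.+ ∣ (Q ∘ fsuc) ─ x ∣) ∎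
    where open ≡-Reasoning

  ∣─∣-pred : ∀ {m k} (Q : Subset m) {x} → Q x ≡ true → ∣ Q ∣ ≡ suc k → ∣ Q ─ x ∣ ≡ k
  ∣─∣-pred Q {x} Qx ∣Q∣≡1+k =
    ℕP.suc-injective (trans (cong (λ b → ind b ℕ.+ ∣ Q ─ x ∣) (sym Qx)) (trans (sym (∣∣-remove Q x)) ∣Q∣≡1+k))

  ∣∩∣≤∣∣ : ∀ {m} (R Q : Subset m) → ∣ R ∩ Q ∣ ≤ ∣ Q ∣
  ∣∩∣≤∣∣ {zero}  R Q = z≤n
  ∣∩∣≤∣∣ {suc m} R Q = ℕP.+-mono-≤ (ind-∧ (R fzero) (Q fzero)) (∣∩∣≤∣∣ (R ∘ fsuc) (Q ∘ fsuc))
    where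
    ind-∧ : ∀ a b → ind (a ∧ b) ≤ ind b
    ind-∧ true  b = ℕP.≤-refl
    ind-∧ false b = z≤n

  <ᵇ-irrefl : ∀ n → (n <ᵇ n) ≡ false
  <ᵇ-irrefl zero    = refl
  <ᵇ-irrefl (suc n) = <ᵇ-irrefl n

  rank-─ : ∀ {m} (Q : Subset m) x → rank (Q ─ x) x ≡ rank Q x
  rank-─ Q x = ∣∣-cong pointwise
    where
    pointwise : ∀ y → below x y ∧ (not (does (x ≟ y)) ∧ Q y) ≡ below x y ∧ Q y
    pointwise y with x ≟ y
    ... | yes refl rewrite <ᵇ-irrefl (toℕ x) = refl
    ... | no  _    = refl

  greaterCount≡rank : ∀ {m k} (Q : Subset m) x (w : Vec (Fin m) k) →
    isArrangement Q w ≡ true → ∣ Q ∣ ≡ k → greaterCount x w ≡ rank Q x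
  greaterCount≡rank Q x [] _ ∣Q∣≡0 =
    sym (ℕP.n≤0⇒n≡0 (subst (rank Q x ℕ.≤_) ∣Q∣≡0 (∣∩∣≤∣∣ (below x) Q)))
  greaterCount≡rank {k = suc k} Q x (z ∷ w) arr ∣Q∣≡1+k = begin
    ind (below x z) ℕ.+ greaterCount x w
      ≡⟨ cong (ind (below x z) ℕ.+_) (greaterCount≡rank (Q ─ z) x w (∧-conicalʳ (Q z) _ arr) (∣─∣-pred Q Qz ∣Q∣≡1+k)) ⟩
    ind (below x z) ℕ.+ rank (Q ─ z) x
      ≡⟨ cong₂ ℕ._+_ (cong ind (sym (trans (cong (below x z ∧_) Qz) (∧-identityʳ (below x z)))))
                     (∣∣-cong (λ y → x∧yz≡y∧xz (below x y) (not (does (z ≟ y))) (Q y))) ⟩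
    ind (below x z ∧ Q z) ℕ.+ ∣ (below x ∩ Q) ─ z ∣
      ≡⟨ ∣∣-remove (below x ∩ Q) z ⟨
    rank Q x ∎
    where
    open ≡-Reasoning
    Qz : Q z ≡ true
    Qz = ∧-conicalˡ (Q z) _ arr

  ∑-rank : ∀ {m} (Q : Subset m) (h : ℕ → ℤ) → ℤΣ.sum (λ x → + ind (Q x) * h (rank Q x)) ≡ ∑< ∣ Q ∣ h
  ∑-rank {zero}  Q h = refl
  ∑-rank {suc m} Q h = begin
    + ind (Q fzero) * h (rank Q fzero) + ℤΣ.sum (λ x → + ind (Q (fsuc x)) * h (ind (Q fzero) ℕ.+ rank (Q ∘ fsuc) x))
      ≡⟨ cong₂ _+_ (cong (λ r → + ind (Q fzero) * h r) rank-fzero)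
                   (∑-rank (Q ∘ fsuc) (h ∘ (ind (Q fzero) ℕ.+_))) ⟩
    + ind (Q fzero) * h 0 + ∑< ∣ Q ∘ fsuc ∣ (h ∘ (ind (Q fzero) ℕ.+_))
      ≡⟨ headRank (Q fzero) ⟩
    ∑< (ind (Q fzero) ℕ.+ ∣ Q ∘ fsuc ∣) h ∎
    where
    open ≡-Reasoning
    rank-fzero : rank Q fzero ≡ 0
    rank-fzero = ℕΣ.sum-replicate-zero (suc m)
    headRank : ∀ b → + ind b * h 0 + ∑< ∣ Q ∘ fsuc ∣ (h ∘ (ind b ℕ.+_)) ≡ ∑< (ind b ℕ.+ ∣ Q ∘ fsuc ∣) h
    headRank true  = cong (_+ ∑< ∣ Q ∘ fsuc ∣ (h ∘ suc)) (ℤP.*-identityˡ (h 0))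
    headRank false = ℤP.+-identityˡ _

  arrangementSeries≗[]q! : ∀ {m} k (Q : Subset m) → ∣ Q ∣ ≡ k → arrangementSeries k Q ≗ [ k ]q!
  arrangementSeries≗[]q! zero Q _ s = trans (ℤP.+-identityʳ _) (ℤP.*-identityˡ (1ₛ s))
  arrangementSeries≗[]q! {m} (suc k) Q ∣Q∣≡1+k s = begin
    arrangementSeries (suc k) Q s
      ≡⟨ ΣL-allWords k m _ ⟩
    ℤΣ.sum (λ x → ΣL (allWords k m) (λ w → + ind (Q x ∧ isArrangement (Q ─ x) w) * q^ (greaterCount x w ℕ.+ inversions w) s))
      ≡⟨ ℤΣ.sum-cong-≗ {m} firstLetter ⟩
    ℤΣ.sum (λ x → + ind (Q x) * shift (rank Q x) [ k ]q! s)
      ≡⟨ ∑-rank Q (λ r → shift r [ k ]q! s) ⟩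
    ∑< ∣ Q ∣ (λ r → shift r [ k ]q! s)
      ≡⟨ cong (λ N → ∑< N (λ r → shift r [ k ]q! s)) ∣Q∣≡1+k ⟩
    ∑< (suc k) (λ r → shift r [ k ]q! s)
      ≡⟨ [ suc k ]q*ₛ [ k ]q! s ⟨
    ([ suc k ]q *ₛ [ k ]q!) s
      ≡⟨ *ₛ-comm [ suc k ]q [ k ]q! s ⟩
    [ suc k ]q! s ∎
    where
    open ≡-Reasoning
    L : List (Vec (Fin m) k)
    L = allWords k m

    firstLetter : ∀ x → ΣL L (λ w → + ind (Q x ∧ isArrangement (Q ─ x) w) * q^ (greaterCount x w ℕ.+ inversions w) s)
                        ≡ + ind (Q x) * shift (rank Q x) [ k ]q! s
    firstLetter x with Q x in Qx
    ... | false = ΣL-zero L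
    ... | true  = begin
      ΣL L (λ w → + ind (isArrangement (Q ─ x) w) * q^ (greaterCount x w ℕ.+ inversions w) s)
        ≡⟨ ΣL-cong L exponent ⟩
      ΣL L (λ w → + ind (isArrangement (Q ─ x) w) * shift (rank Q x) (q^ (inversions w)) s)
        ≡⟨ ΣL-cong L (λ w → shift-·ₛ (rank Q x) (+ ind (isArrangement (Q ─ x) w)) (q^ (inversions w)) s) ⟨
      ΣL L (λ w → shift (rank Q x) (+ ind (isArrangement (Q ─ x) w) ·ₛ q^ (inversions w)) s)
        ≡⟨ shift-ΣL (rank Q x) L (λ w → + ind (isArrangement (Q ─ x) w) ·ₛ q^ (inversions w)) s ⟨
      shift (rank Q x) (arrangementSeries k (Q ─ x)) s
        ≡⟨ shift-cong (rank Q x) (arrangementSeries≗[]q! k (Q ─ x) ∣Q─x∣≡k) s ⟩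
      shift (rank Q x) [ k ]q! s
        ≡⟨ ℤP.*-identityˡ _ ⟨
      + 1 * shift (rank Q x) [ k ]q! s ∎
      where
      ∣Q─x∣≡k : ∣ Q ─ x ∣ ≡ k
      ∣Q─x∣≡k = ∣─∣-pred Q Qx ∣Q∣≡1+k
      exponent : ∀ w → + ind (isArrangement (Q ─ x) w) * q^ (greaterCount x w ℕ.+ inversions w) s
                     ≡ + ind (isArrangement (Q ─ x) w) * shift (rank Q x) (q^ (inversions w)) s
      exponent w with isArrangement (Q ─ x) w in arr
      ... | false = refl
      ... | true  = cong (+ 1 *_) (trans
        (cong (λ r → q^ (r ℕ.+ inversions w) s) (trans (greaterCount≡rank (Q ─ x) x w arr ∣Q─x∣≡k) (rank-─ Q x)))
        (sym (shift-shift (rank Q x) (inversions w) 1ₛ s)))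

  allIn : ∀ {m k} → Subset m → Vec (Fin m) k → Bool
  allIn Q []      = true
  allIn Q (x ∷ w) = Q x ∧ allIn Q w

  allIn-─ : ∀ {m k} (Q : Subset m) x (w : Vec (Fin m) k) → allIn (Q ─ x) w ≡ notIn x w ∧ allIn Q w
  allIn-─ Q x []      = refl
  allIn-─ Q x (y ∷ w) =
    trans (cong ((Q ─ x) y ∧_) (allIn-─ Q x w)) (∧-interchange (not (does (x ≟ y))) (Q y) (notIn x w) (allIn Q w))

  isArrangement≡allIn∧distinct : ∀ {m k} (Q : Subset m) (w : Vec (Fin m) k) → isArrangement Q w ≡ allIn Q w ∧ distinct w
  isArrangement≡allIn∧distinct Q []      = refl
  isArrangement≡allIn∧distinct Q (x ∷ w) = begin
    Q x ∧ isArrangement (Q ─ x) w                  ≡⟨ cong (Q x ∧_) (isArrangement≡allIn∧distinct (Q ─ x) w) ⟩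
    Q x ∧ (allIn (Q ─ x) w ∧ distinct w)           ≡⟨ cong (λ b → Q x ∧ (b ∧ distinct w)) (allIn-─ Q x w) ⟩
    Q x ∧ ((notIn x w ∧ allIn Q w) ∧ distinct w)   ≡⟨ cong (λ b → Q x ∧ (b ∧ distinct w)) (∧-comm (notIn x w) (allIn Q w)) ⟩
    Q x ∧ ((allIn Q w ∧ notIn x w) ∧ distinct w)   ≡⟨ cong (Q x ∧_) (∧-assoc (allIn Q w) (notIn x w) (distinct w)) ⟩
    Q x ∧ (allIn Q w ∧ (notIn x w ∧ distinct w))   ≡⟨ ∧-assoc (Q x) (allIn Q w) _ ⟨
    (Q x ∧ allIn Q w) ∧ (notIn x w ∧ distinct w)   ∎
    where open ≡-Reasoning

  full : ∀ {m} → Subset m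
  full _ = true

  ∣full∣ : ∀ m → ∣ full {m} ∣ ≡ m
  ∣full∣ zero    = refl
  ∣full∣ (suc m) = cong suc (∣full∣ m)

  isArrangement-full : ∀ {m k} (w : Vec (Fin m) k) → isArrangement full w ≡ distinct w
  isArrangement-full w = trans (isArrangement≡allIn∧distinct full w) (cong (_∧ distinct w) (allIn-full w))
    where
    allIn-full : ∀ {k} (w : Vec (Fin _) k) → allIn full w ≡ true
    allIn-full []      = refl
    allIn-full (x ∷ w) = allIn-full w

  I≡[]q! : ∀ n s → + I n s ≡ [ n ]q! s
  I≡[]q! n s = begin
    + I n s
      ≡⟨ length-ΣL (filter (T? ∘ (λ w → inversions w ℕ.≡ᵇ s)) permutations′) ⟩
    ΣL (filter (T? ∘ (λ w → inversions w ℕ.≡ᵇ s)) permutations′) (λ _ → + 1)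
      ≡⟨ ΣL-filter (λ w → inversions w ℕ.≡ᵇ s) permutations′ _ ⟩
    ΣL permutations′ (λ w → + ind (inversions w ℕ.≡ᵇ s) * + 1)
      ≡⟨ ΣL-filter distinct (allWords n n) _ ⟩
    ΣL (allWords n n) (λ w → + ind (distinct w) * (+ ind (inversions w ℕ.≡ᵇ s) * + 1))
      ≡⟨ ΣL-cong (allWords n n) (λ w → cong₂ (λ b c → + ind b * c) (sym (isArrangement-full w))
                                             (trans (ℤP.*-identityʳ _) (sym (q^-coeff (inversions w) s)))) ⟩
    arrangementSeries n full s
      ≡⟨ arrangementSeries≗[]q! n full (∣full∣ n) s ⟩
    [ n ]q! s ∎
    where
    open ≡-Reasoning
    permutations′ : List (Vec (Fin n) n)
    permutations′ = filter (T? ∘ distinct) (allWords n n)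

  binom₀-+ : ∀ {a n} → n ≤ a → binom₀ (+ a) n ≡ a C n
  binom₀-+ {a} {n} n≤a with a <ᵇ n | ℕP.<ᵇ-reflects-< a n
  ... | true  | ofʸ a<n = contradiction a<n (ℕP.≤⇒≯ n≤a)
  ... | false | _       = refl

  binom₀-< : ∀ {a n} → a Int.< + n → binom₀ a n ≡ 0
  binom₀-< {+ a} {n} (Int.+<+ a<n) with a <ᵇ n | ℕP.<ᵇ-reflects-< a n
  ... | true  | _        = refl
  ... | false | ofⁿ a≮n = contradiction a<n a≮n
  binom₀-< {Int.-[1+ _ ]} _ = refl

  m-n+o≡m+o⊖n : ∀ m n o → (+ m - + n) + + o ≡ (m ℕ.+ o) ⊖ n
  m-n+o≡m+o⊖n m n o = begin
    (+ m - + n) + + o     ≡⟨ regroup (+ m) (+ n) (+ o) ⟩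
    (+ m + + o) - + n     ≡⟨ cong (_- + n) (ℤP.pos-+ m o) ⟨
    + (m ℕ.+ o) - + n     ≡⟨ ℤP.m-n≡m⊖n (m ℕ.+ o) n ⟩
    (m ℕ.+ o) ⊖ n         ∎
    where
    open ≡-Reasoning
    regroup : ∀ a b c → (a - b) + c ≡ (a + c) - b
    regroup = solve-∀

  binom₀-≤ : ∀ {t k} n → k ≤ t → binom₀ ((+ t - + k) + + n) n ≡ (t ∸ k ℕ.+ n) C n
  binom₀-≤ {t} {k} n k≤t = begin
    binom₀ ((+ t - + k) + + n) n     ≡⟨ cong (λ a → binom₀ a n) (m-n+o≡m+o⊖n t k n) ⟩
    binom₀ ((t ℕ.+ n) ⊖ k) n         ≡⟨ cong (λ a → binom₀ a n) (ℤP.⊖-≥ (ℕP.≤-trans k≤t (ℕP.m≤m+n t n))) ⟩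
    binom₀ (+ (t ℕ.+ n ∸ k)) n       ≡⟨ cong (λ a → binom₀ (+ a) n) (ℕP.+-∸-comm n k≤t) ⟩
    binom₀ (+ (t ∸ k ℕ.+ n)) n       ≡⟨ binom₀-+ (ℕP.m≤n+m n (t ∸ k)) ⟩
    (t ∸ k ℕ.+ n) C n                ∎
    where open ≡-Reasoning

  binom₀-> : ∀ {t k} n → t < k → binom₀ ((+ t - + k) + + n) n ≡ 0
  binom₀-> {t} {k} n t<k = binom₀-< (begin-strict
    (+ t - + k) + + n    ≡⟨ m-n+o≡m+o⊖n t k n ⟩
    (t ℕ.+ n) ⊖ k        <⟨ ℤP.⊖-monoʳ->-< (t ℕ.+ n) t<k ⟩
    (t ℕ.+ n) ⊖ t        ≡⟨ ℤP.⊖-≥ (ℕP.m≤m+n t n) ⟩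
    + (t ℕ.+ n ∸ t)      ≡⟨ cong +_ (ℕP.m+n∸m≡n t n) ⟩
    + n                  ∎)
    where open ℤP.≤-Reasoning

  qBinomialTerm₀*geometric^ : ∀ n t → (qBinomialTerm n 0 *ₛ geometric^ (suc n)) t ≡ + ((n ℕ.+ t) C t)
  qBinomialTerm₀*geometric^ n t = begin
    ((+ 1 ·ₛ 1ₛ) *ₛ geometric^ (suc n)) t      ≡⟨ ·ₛ-*ₛ (+ 1) 1ₛ (geometric^ (suc n)) t ⟩
    + 1 * (1ₛ *ₛ geometric^ (suc n)) t         ≡⟨ ℤP.*-identityˡ _ ⟩
    (1ₛ *ₛ geometric^ (suc n)) t               ≡⟨ *ₛ-identityˡ (geometric^ (suc n)) t ⟩
    geometric^ (suc n) t                       ≡⟨ geometric^-coeff n t ⟩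
    + ((t ℕ.+ n) C n)                          ≡⟨ cong +_ (nCk≡nC[n∸k] (ℕP.m≤n+m n t)) ⟩
    + ((t ℕ.+ n) C (t ℕ.+ n ∸ n))              ≡⟨ cong (λ k → + ((t ℕ.+ n) C k)) (ℕP.m+n∸n≡m t n) ⟩
    + ((t ℕ.+ n) C t)                          ≡⟨ cong (λ a → + (a C t)) (ℕP.+-comm t n) ⟩
    + ((n ℕ.+ t) C t)                          ∎
    where open ≡-Reasoning

  qBinomialTerm*geometric^ : ∀ {n j t} → j ≤ n → t ≤ triangular n →
    (qBinomialTerm n j *ₛ geometric^ (suc n)) t
      ≡ Σℤ[ (j ℕ.+ 1) C 2 to (n ℕ.+ 1) C 2 ] (λ k →
          (- (+ 1)) ^ j * gaussCoeff n j (k ∸ (j ℕ.+ 1) C 2) * + binom₀ ((+ t - + k) + + n) n)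
  qBinomialTerm*geometric^ {n} {j} {t} j≤n t≤Tn rewrite triangular≡C j | triangular≡C n = begin
    (E *ₛ geometric^ (suc n)) t
      ≡⟨ *ₛ-coeff E (geometric^ (suc n)) t ⟩
    ∑< (suc t) (λ k → E k * geometric^ (suc n) (t ∸ k))
      ≡⟨ ∑<-cong-< (suc t) (λ k k≤t → cong (E k *_) (geometric^≡B k (ℕP.≤-pred k≤t))) ⟩
    ∑< (suc t) (λ k → E k * B k)
      ≡⟨ ∑<-extend (λ k → E k * B k) (s≤s t≤Tn) (λ k t<k → trans (cong (E k *_) (cong +_ (binom₀-> n t<k))) (ℤP.*-zeroʳ (E k))) ⟩
    ∑< (suc (triangular n)) (λ k → E k * B k)
      ≡⟨ ∑<-drop (λ k → E k * B k) (ℕP.m≤n⇒m≤1+n (triangular-mono j≤n))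
                 (λ k k<Tj → trans (cong (_* B k) (E-below k k<Tj)) (ℤP.*-zeroˡ (B k))) ⟩
    ∑< (suc (triangular n) ∸ triangular j) (λ i → E (triangular j ℕ.+ i) * B (triangular j ℕ.+ i))
      ≡⟨ ∑<-cong (suc (triangular n) ∸ triangular j) (λ i → cong (_* B (triangular j ℕ.+ i)) (E-above i)) ⟩
    ∑< (suc (triangular n) ∸ triangular j) (λ i → F (triangular j ℕ.+ i))
      ≡⟨ Σℤ-∑< (triangular j) (triangular n) F ⟨
    Σℤ[ triangular j to triangular n ] F ∎
    where
    open ≡-Reasoning
    E : Series
    E = qBinomialTerm n j
    B F : ℕ → ℤ
    B k = + binom₀ ((+ t - + k) + + n) n
    F k = (- (+ 1)) ^ j * gaussCoeff n j (k ∸ triangular j) * B k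

    geometric^≡B : ∀ k → k ≤ t → geometric^ (suc n) (t ∸ k) ≡ B k
    geometric^≡B k k≤t = trans (geometric^-coeff n (t ∸ k)) (cong +_ (sym (binom₀-≤ n k≤t)))

    E-below : ∀ k → k < triangular j → E k ≡ + 0
    E-below k k<Tj = trans (cong ((- (+ 1)) ^ j *_) (shift-< (triangular j) (qBinomial n j) k k<Tj)) (ℤP.*-zeroʳ ((- (+ 1)) ^ j))

    E-above : ∀ i → E (triangular j ℕ.+ i) ≡ (- (+ 1)) ^ j * gaussCoeff n j (triangular j ℕ.+ i ∸ triangular j)
    E-above i = cong ((- (+ 1)) ^ j *_) (begin
      shift (triangular j) (qBinomial n j) (triangular j ℕ.+ i) ≡⟨ shift-+ (triangular j) (qBinomial n j) i ⟩
      qBinomial n j i                                         ≡⟨ gaussCoeff≗qBinomial j≤n i ⟨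
      gaussCoeff n j i                                        ≡⟨ cong (gaussCoeff n j) (ℕP.m+n∸m≡n (triangular j) i) ⟨
      gaussCoeff n j (triangular j ℕ.+ i ∸ triangular j)      ∎)

  qPochhammer*ₛ : ∀ n g t → (qPochhammer n *ₛ g) t ≡ ∑< (suc n) (λ j → (qBinomialTerm n j *ₛ g) t)
  qPochhammer*ₛ n g t = trans (*ₛ-congˡ g (qBinomialTheorem n) t) (∑<-*ₛ (suc n) (qBinomialTerm n) g t)

  partialSums-I : ∀ n t → + Σℕ[ 0 to t ] (I n) ≡ (qPochhammer n *ₛ geometric^ (suc n)) t
  partialSums-I n t = begin
    + Σℕ[ 0 to t ] (I n)                             ≡⟨ Σℕ-∑< t (I n) ⟩
    ∑< (suc t) (+_ ∘ I n)                            ≡⟨ ∑<-cong (suc t) (I≡[]q! n) ⟩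
    ∑< (suc t) [ n ]q!                               ≡⟨ *ₛ-geometric [ n ]q! t ⟨
    ([ n ]q! *ₛ geometric) t                         ≡⟨ *ₛ-congˡ geometric (qPochhammer*geometric^ n) t ⟨
    (qPochhammer n *ₛ geometric^ n *ₛ geometric) t   ≡⟨ *ₛ-assoc (qPochhammer n) (geometric^ n) geometric t ⟩
    (qPochhammer n *ₛ geometric^ (suc n)) t          ∎
    where open ≡-Reasoning

open import Data.Nat using (ℕ; _+_; _≤_)
open import Data.Nat.Combinatorics using (_C_)
open import Data.Integer using (ℤ; +_; -_; _-_; _*_; _^_)
open import Relation.Binary.PropositionalEquality using (_≡_)

theorem3p2 : (n t : ℕ) → 1 ≤ n → t ≤ n C 2 →
    Data.Integer.+ (Σℕ[ 0 to t ] (λ i → I n i))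
      ≡ Data.Integer._+_ (+ ((n + t) C t))
          (Σℤ[ 1 to n ] (λ j →
            Σℤ[ (j + 1) C 2 to (n + 1) C 2 ] (λ k →
              ((- (+ 1)) ^ j) * gaussCoeff n j (Data.Nat._∸_ k ((j + 1) C 2))
                * (+ binom₀ ((+ t - + k) Data.Integer.+ + n) n))))
theorem3p2 n t _ t≤nC2 = begin
  + Σℕ[ 0 to t ] (I n)                                          ≡⟨ partialSums-I n t ⟩
  (qPochhammer n *ₛ geometric^ (suc n)) t                        ≡⟨ qPochhammer*ₛ n (geometric^ (suc n)) t ⟩
  ∑< (suc n) (λ j → (qBinomialTerm n j *ₛ geometric^ (suc n)) t)
    ≡⟨ cong₂ Int._+_ (qBinomialTerm₀*geometric^ n t)
                     (∑<-cong-< n (λ j j<n → qBinomialTerm*geometric^ j<n t≤Tn)) ⟩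
  + ((n + t) C t) Int.+ ∑< n (summand ∘ suc)                    ≡⟨ cong (Int._+_ (+ ((n + t) C t))) (Σℤ-∑< 1 n summand) ⟨
  + ((n + t) C t) Int.+ Σℤ[ 1 to n ] summand                     ∎
  where
  open ≡-Reasoning
  t≤Tn : t ≤ triangular n
  t≤Tn = ℕP.≤-trans t≤nC2 (C2≤triangular n)
  summand : ℕ → ℤ
  summand j = Σℤ[ (j + 1) C 2 to (n + 1) C 2 ] (λ k →
    (- (+ 1)) ^ j * gaussCoeff n j (k ∸ (j + 1) C 2) * + binom₀ ((+ t - + k) Int.+ + n) n)
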